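{- For any positive integers $\ell,N$ and nonnegative integer $n$, there exists $N^*$ such that the following holds. Let $m$ be a positive integer. If $\mathcal{F}$ is an $(m,\ell,N)$-nice class of graphs, then $\mathcal{F}^{+n}$ is $(m,\ell,N^*)$-nice.
   Context: All graphs are finite. $G^\ell$ is obtained from $G$ by adding an edge between every two distinct vertices at distance at most $\ell$ in $G$. An $m$-coloring of $H$ is a function $V(H)\to[m]$; it has weak diameter in $H$ at most $d$ if any two vertices in a common monochromatic component (component of the subgraph of $H$ induced by a color class) are at distance at most $d$ in $H$. A class $\mathcal{F}$ is $(m,\ell,N)$-nice if for every $G\in\mathcal{F}$, $G^\ell$ has an $m$-coloring with weak diameter in $G^\ell$ at most $N$. $\mathcal{F}^{+n}$ is the class of graphs $G$ for which some $Z\subseteq V(G)$ with $|Z|\le n$ satisfies $G-Z\in\mathcal{F}$. -}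

module Defs where

open import Data.Nat using (ℕ; zero; suc; _≤_)
open import Data.Fin using (Fin)
open import Data.Bool using (Bool; false; T)
open import Data.List using (List; length)
open import Data.List.Membership.Propositional using (_∈_)
open import Data.Product using (Σ; _×_; ∃; ∃-syntax; _,_)
open import Relation.Binary.PropositionalEquality using (_≡_; _≢_)
open import Relation.Nullary using (¬_)
open import Function.Bundles using (_⇔_)
open import Function.Definitions using (Injective)

-- A finite simple graph on vertex set Fin k.
-- Adjacency is given by a Boolean matrix (finite graphs have decidable adjacency);
-- Adj G u v is the proposition that u and v are adjacent.
record Graph (k : ℕ) : Set where
  field
    adj    : Fin k → Fin k → Bool
    sym    : ∀ u v → adj u v ≡ adj v u
    irrefl : ∀ u → adj u u ≡ false
open Graph public

Adj : ∀ {k} → Graph k → Fin k → Fin k → Set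
Adj G u v = T (adj G u v)

-- For a symmetric relation R on Fin k (the adjacency relation of a graph),
-- Within R d u v : dist_R(u,v) ≤ d, i.e. there is a walk of length ≤ d from u to v.
data Within {k : ℕ} (R : Fin k → Fin k → Set) : ℕ → Fin k → Fin k → Set where
  here : ∀ {d u} → Within R d u u
  step : ∀ {d u w v} → R u w → Within R d w v → Within R (suc d) u v

PowAdj : ∀ {k} → Graph k → ℕ → Fin k → Fin k → Set
PowAdj G ℓ u v = (u ≢ v) × Within (Adj G) ℓ u v

Coloring : ℕ → ℕ → Set
Coloring k m = Fin k → Fin m

data SameMonoComp {k m : ℕ} (R : Fin k → Fin k → Set) (c : Coloring k m) : Fin k → Fin k → Set where
  here : ∀ {u} → SameMonoComp R c u u
  step : ∀ {u w v} → R u w → c u ≡ c w → SameMonoComp R c w v → SameMonoComp R c u v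

WeakDiamAtMost : ∀ {k m} (R : Fin k → Fin k → Set) → Coloring k m → ℕ → Set
WeakDiamAtMost R c d = ∀ u v → SameMonoComp R c u v → Within R d u v

GraphClass : Set₁
GraphClass = (k : ℕ) → Graph k → Set

Nice : ℕ → ℕ → ℕ → GraphClass → Set
Nice m ℓ N F = ∀ k (G : Graph k) → F k G →
  Σ (Coloring k m) λ c → WeakDiamAtMost (PowAdj G ℓ) c N

-- G - Z ∈ F, with G - Z represented up to isomorphism: there is a graph H ∈ F
-- on Fin k' and an isomorphism f from H onto the induced subgraph G[V(G) ∖ Z].
MinusIn : GraphClass → ∀ {k} → Graph k → List (Fin k) → Set
MinusIn F {k} G Z =
  ∃[ k' ] Σ (Graph k') λ H → Σ (Fin k' → Fin k) λ f →
      Injective _≡_ _≡_ f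
    × (∀ i → ¬ (f i ∈ Z))
    × (∀ v → ¬ (v ∈ Z) → ∃[ i ] f i ≡ v)
    × (∀ i j → Adj H i j ⇔ Adj G (f i) (f j))
    × F k' H

PlusN : GraphClass → ℕ → GraphClass
PlusN F n k G = Σ (List (Fin k)) λ Z → (length Z ≤ n) × MinusIn F G Z

module Submission where

-- Let G be in F^{+n}: deleting a set Z of at most n
-- vertices leaves a graph isomorphic to some H in F, and H^ℓ has an m-colouring
-- cH of weak diameter at most N.  Colour G by giving every vertex of Z the
-- colour 0 and every other vertex the colour of its preimage in H.
--
-- An edge of G^ℓ is either "clean" (it is the image of an edge of H^ℓ) or both
-- of its ends lie within one G^ℓ-step of a common vertex z of Z.  Hence a
-- monochromatic walk in G^ℓ decomposes into a clean monochromatic run, a walk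
-- through vertices of Z whose steps are "detours" (one step, a clean run, one
-- step), and a final clean run.  Clean runs have length at most N by the
-- colouring of H^ℓ, and a walk whose vertices all lie in the list Z can be
-- shortened to length bounded in terms of |Z| ≤ n alone.  Together this bounds
-- the weak diameter by a number N* depending only on N and n.

open import Defs
open import Data.Nat using (ℕ; zero; suc; _≤_; _+_; _*_; z≤n; s≤s)
open import Data.Nat.Properties
  using (≤-reflexive; ≤-refl; ≤-trans; +-comm; +-suc; m≤m+n; m≤n+m; n≤1+n; +-mono-≤; *-monoˡ-≤)
open import Data.Product using (∃-syntax; Σ; _×_; _,_; proj₁; proj₂)
open import Data.Sum using (_⊎_; inj₁; inj₂)
open import Data.Fin using (Fin)
import Data.Fin as Fin
open import Data.Fin.Properties using (_≟_)
open import Data.List using (List; []; _∷_; length)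
open import Data.List.Relation.Unary.Any using (here; there)
open import Data.List.Membership.Propositional using (_∈_)
import Data.List.Membership.DecPropositional as DecMembership
open import Data.Bool using (T)
open import Data.Empty using (⊥-elim)
open import Relation.Nullary using (¬_; yes; no)
open import Relation.Binary.PropositionalEquality
  using (_≡_; refl; cong; subst; trans) renaming (sym to ≡-sym)
open import Function.Bundles using (_⇔_; Equivalence)
open import Function.Definitions using (Injective)

module WalkAlgebra {k : ℕ} (R : Fin k → Fin k → Set) where

  weaken : ∀ {d d' u v} → d ≤ d' → Within R d u v → Within R d' u v
  weaken _         here       = here
  weaken (s≤s d≤d') (step r w) = step r (weaken d≤d' w)

  single : ∀ {u v} → R u v → Within R 1 u v
  single r = step r here

  _++_ : ∀ {d e u w v} → Within R d u w → Within R e w v → Within R (d + e) u v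
  _++_ {d} {e} here q = weaken (m≤n+m e d) q
  step r p ++ q       = step r (p ++ q)

  reverse : (∀ {a b} → R a b → R b a) → ∀ {d u v} → Within R d u v → Within R d v u
  reverse R-sym here               = here
  reverse R-sym {suc d} (step r w) =
    weaken (≤-reflexive (+-comm d 1)) (reverse R-sym w ++ single (R-sym r))

  flatten : ∀ {e} {Q : Fin k → Fin k → Set} → (∀ {a b} → Q a b → Within R e a b) →
            ∀ {d u v} → Within Q d u v → Within R (d * e) u v
  flatten g here       = here
  flatten g (step q w) = g q ++ flatten g w

data WalkIn {k : ℕ} (L : List (Fin k)) (Q : Fin k → Fin k → Set) : Fin k → Fin k → Set where
  here : ∀ {z} → z ∈ L → WalkIn L Q z z
  step : ∀ {z w z'} → z ∈ L → Q z w → WalkIn L Q w z' → WalkIn L Q z z'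

-- Length bound for a shortened walk inside a list of n vertices:
-- removing one vertex a costs at most a walk into a and a walk out of a.
shortcutBound : ℕ → ℕ
shortcutBound zero    = 0
shortcutBound (suc n) = suc (suc (shortcutBound n + shortcutBound n))

shortcutBound-mono : ∀ {m n} → m ≤ n → shortcutBound m ≤ shortcutBound n
shortcutBound-mono {zero}  _         = z≤n
shortcutBound-mono {suc m} (s≤s m≤n) =
  s≤s (s≤s (+-mono-≤ (shortcutBound-mono m≤n) (shortcutBound-mono m≤n)))

module Shortcut {k : ℕ} (Q : Fin k → Fin k → Set) where
  open WalkAlgebra Q

  Into : List (Fin k) → Fin k → Fin k → Set
  Into L' z a = z ≡ a ⊎ Σ (Fin k) λ w → WalkIn L' Q z w × Q w a

  OutOf : List (Fin k) → Fin k → Fin k → Set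
  OutOf L' a z' = a ≡ z' ⊎ Σ (Fin k) λ w → Q a w × WalkIn L' Q w z'

  splitAtFirst : ∀ {a L' z z'} → WalkIn (a ∷ L') Q z z' → WalkIn L' Q z z' ⊎ Into L' z a
  splitAtFirst (here (here z≡a))        = inj₂ (inj₁ z≡a)
  splitAtFirst (here (there z∈L'))      = inj₁ (here z∈L')
  splitAtFirst (step (here z≡a) _ _)    = inj₂ (inj₁ z≡a)
  splitAtFirst (step (there z∈L') q rest) with splitAtFirst rest
  ... | inj₁ w                      = inj₁ (step z∈L' q w)
  ... | inj₂ (inj₁ refl)            = inj₂ (inj₂ (_ , here z∈L' , q))
  ... | inj₂ (inj₂ (w , wk , q'))   = inj₂ (inj₂ (w , step z∈L' q wk , q'))

  splitAtLast : ∀ {a L' z z'} → WalkIn (a ∷ L') Q z z' → WalkIn L' Q z z' ⊎ OutOf L' a z'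
  splitAtLast (here (here refl))   = inj₂ (inj₁ refl)
  splitAtLast (here (there z∈L'))  = inj₁ (here z∈L')
  splitAtLast (step z∈L q rest) with splitAtLast rest
  ... | inj₂ out = inj₂ out
  splitAtLast (step (here refl) q rest)   | inj₁ w = inj₂ (inj₂ (_ , q , w))
  splitAtLast (step (there z∈L') q rest)  | inj₁ w = inj₁ (step z∈L' q w)

  shortcut : ∀ L {z z'} → WalkIn L Q z z' → Within Q (shortcutBound (length L)) z z'
  shortcut [] (here ())
  shortcut [] (step () _ _)
  shortcut (a ∷ L') wk with splitAtFirst wk
  ... | inj₁ w = weaken (shortcutBound-mono (n≤1+n _)) (shortcut L' w)
  ... | inj₂ into with splitAtLast wk
  ...   | inj₁ w   = weaken (shortcutBound-mono (n≤1+n _)) (shortcut L' w)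
  ...   | inj₂ out = weaken (≤-reflexive (cong suc (+-suc _ _))) (toA into ++ fromA out)
    where
    toA : ∀ {z} → Into L' z a → Within Q (suc (shortcutBound (length L'))) z a
    toA (inj₁ refl)          = here
    toA (inj₂ (w , wk' , q)) = weaken (≤-reflexive (+-comm _ 1)) (shortcut L' wk' ++ single q)

    fromA : ∀ {z'} → OutOf L' a z' → Within Q (suc (shortcutBound (length L'))) a z'
    fromA (inj₁ refl)          = here
    fromA (inj₂ (w , q , wk')) = step q (shortcut L' wk')

NearCommon : ∀ {k} → (Fin k → Fin k → Set) → List (Fin k) → Fin k → Fin k → Set
NearCommon {k} R Z u w = Σ (Fin k) λ z → z ∈ Z × Within R 1 u z × Within R 1 w z

diameterBound : ℕ → ℕ → ℕ
diameterBound N n = (N + 1) + (shortcutBound n * suc (N + 1) + (1 + N))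

module Decompose {k m : ℕ} (R : Fin k → Fin k → Set) (R-sym : ∀ {a b} → R a b → R b a)
  (c : Coloring k m) (Clean : Fin k → Fin k → Set) (Z : List (Fin k)) (N : ℕ)
  (cleanRun : ∀ {u v} → SameMonoComp Clean c u v → Within R N u v)
  (classify : ∀ {u w} → R u w → Clean u w ⊎ NearCommon R Z u w) where
  open WalkAlgebra R

  Detour : Fin k → Fin k → Set
  Detour z z' = Σ (Fin k) λ a → Σ (Fin k) λ b →
    Within R 1 a z × SameMonoComp Clean c a b × Within R 1 b z'

  detourLength : ∀ {z z'} → Detour z z' → Within R (suc (N + 1)) z z'
  detourLength (_ , _ , a→z , run , b→z') = reverse R-sym a→z ++ (cleanRun run ++ b→z')

  Decomposition : Fin k → Fin k → Set
  Decomposition u v = SameMonoComp Clean c u v ⊎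
    (Σ (Fin k) λ x → Σ (Fin k) λ z → Σ (Fin k) λ z' → Σ (Fin k) λ y →
      SameMonoComp Clean c u x × Within R 1 x z × WalkIn Z Detour z z' ×
      Within R 1 y z' × SameMonoComp Clean c y v)

  decompose : ∀ {u v} → SameMonoComp R c u v → Decomposition u v
  decompose here = inj₁ here
  decompose (step r same rest) with classify r | decompose rest
  ... | inj₁ cl | inj₁ run = inj₁ (step cl same run)
  ... | inj₁ cl | inj₂ (x , z , z' , y , run , x→z , wk , y→z' , run') =
    inj₂ (x , z , z' , y , step cl same run , x→z , wk , y→z' , run')
  ... | inj₂ (z₀ , z₀∈Z , u→z₀ , w→z₀) | inj₁ run =
    inj₂ (_ , z₀ , z₀ , _ , here , u→z₀ , here z₀∈Z , w→z₀ , run)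
  ... | inj₂ (z₀ , z₀∈Z , u→z₀ , w→z₀) | inj₂ (x , z , z' , y , run , x→z , wk , y→z' , run') =
    inj₂ (_ , z₀ , z' , y , here , u→z₀ , step z₀∈Z (_ , x , w→z₀ , run , x→z) wk , y→z' , run')

  weakDiameter : ∀ n → length Z ≤ n → ∀ {u v} → SameMonoComp R c u v →
                 Within R (diameterBound N n) u v
  weakDiameter n |Z|≤n s with decompose s
  ... | inj₁ run = weaken (≤-trans (m≤m+n N 1) (m≤m+n (N + 1) _)) (cleanRun run)
  ... | inj₂ (x , z , z' , y , run , x→z , wk , y→z' , run') =
    weaken (+-mono-≤ (≤-refl {N + 1})
             (+-mono-≤ (*-monoˡ-≤ (suc (N + 1)) (shortcutBound-mono |Z|≤n)) (≤-refl {1 + N})))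
      ((cleanRun run ++ x→z) ++
       (flatten detourLength (Shortcut.shortcut Detour Z wk) ++
        (reverse R-sym y→z' ++ cleanRun run')))

module Extension (ℓ N : ℕ) {k k' m : ℕ} (G : Graph k) (Z : List (Fin k)) (H : Graph k')
  (f : Fin k' → Fin k) (f-inj : Injective _≡_ _≡_ f) (f∉Z : ∀ i → ¬ (f i ∈ Z))
  (f-onto : ∀ v → ¬ (v ∈ Z) → ∃[ i ] f i ≡ v)
  (f-iso : ∀ i j → Adj H i j ⇔ Adj G (f i) (f j))
  (cH : Coloring k' (suc m)) (cH-diam : WeakDiamAtMost (PowAdj H ℓ) cH N) where

  open DecMembership (_≟_ {k}) using (_∈?_)

  c : Coloring k (suc m)
  c v with v ∈? Z
  ... | yes _   = Fin.zero
  ... | no v∉Z  = cH (proj₁ (f-onto v v∉Z))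

  c∘f : ∀ i → c (f i) ≡ cH i
  c∘f i with f i ∈? Z
  ... | yes fi∈Z = ⊥-elim (f∉Z i fi∈Z)
  ... | no fi∉Z  = cong cH (f-inj (proj₂ (f-onto (f i) fi∉Z)))

  R : Fin k → Fin k → Set
  R = PowAdj G ℓ

  Clean : Fin k → Fin k → Set
  Clean u w = ∃[ i ] ∃[ j ] (f i ≡ u × f j ≡ w × PowAdj H ℓ i j)

  Adj-sym : ∀ {a b} → Adj G a b → Adj G b a
  Adj-sym {a} {b} = subst T (sym G a b)

  R-sym : ∀ {a b} → R a b → R b a
  R-sym (a≢b , wk) = (λ b≡a → a≢b (≡-sym b≡a)) , WalkAlgebra.reverse (Adj G) Adj-sym wk

  liftWalk : ∀ {d i j} → Within (Adj H) d i j → Within (Adj G) d (f i) (f j)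
  liftWalk here       = here
  liftWalk (step a w) = step (Equivalence.to (f-iso _ _) a) (liftWalk w)

  liftPowWalk : ∀ {d i j} → Within (PowAdj H ℓ) d i j → Within R d (f i) (f j)
  liftPowWalk here                = here
  liftPowWalk (step (i≢j , w) rest) =
    step ((λ fi≡fj → i≢j (f-inj fi≡fj)) , liftWalk w) (liftPowWalk rest)

  pullback : ∀ i {v} → SameMonoComp Clean c (f i) v →
             ∃[ j ] (f j ≡ v × SameMonoComp (PowAdj H ℓ) cH i j)
  pullback i here = i , refl , here
  pullback i (step (i' , j' , fi'≡fi , refl , edge) same rest) with f-inj fi'≡fi
  ... | refl with pullback j' rest
  ...   | (j , fj≡v , s) = j , fj≡v , step edge (trans (≡-sym (c∘f i)) (trans same (c∘f j'))) s

  cleanRun : ∀ {u v} → SameMonoComp Clean c u v → Within R N u v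
  cleanRun here = here
  cleanRun s@(step (i , _ , refl , _ , _) _ _) with pullback i s
  ... | (j , refl , s') = liftPowWalk (cH-diam i j s')

  avoidOrMeet : ∀ {d u w} → ¬ (u ∈ Z) → Within (Adj G) d u w →
    (∃[ i ] ∃[ j ] (f i ≡ u × f j ≡ w × Within (Adj H) d i j)) ⊎
    (Σ (Fin k) λ z → z ∈ Z × Within (Adj G) d u z × Within (Adj G) d z w)
  avoidOrMeet {u = u} u∉Z here with f-onto u u∉Z
  ... | (i , fi≡u) = inj₁ (i , i , fi≡u , fi≡u , here)
  avoidOrMeet {suc d} {u} u∉Z (step {w = x} a rest) with x ∈? Z
  ... | yes x∈Z = inj₂ (x , x∈Z , step a here , WalkAlgebra.weaken (Adj G) (n≤1+n d) rest)
  ... | no x∉Z with avoidOrMeet x∉Z rest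
  ...   | inj₂ (z , z∈Z , x→z , z→w) =
          inj₂ (z , z∈Z , step a x→z , WalkAlgebra.weaken (Adj G) (n≤1+n d) z→w)
  ...   | inj₁ (i' , j , refl , fj≡w , hw) with f-onto u u∉Z
  ...     | (i , refl) = inj₁ (i , j , refl , fj≡w , step (Equivalence.from (f-iso i i') a) hw)

  near : ∀ {u z} → ¬ (u ∈ Z) → z ∈ Z → Within (Adj G) ℓ u z → Within R 1 u z
  near u∉Z z∈Z wk = step ((λ u≡z → u∉Z (subst (_∈ Z) (≡-sym u≡z) z∈Z)) , wk) here

  classify : ∀ {u w} → R u w → Clean u w ⊎ NearCommon R Z u w
  classify {u} {w} (u≢w , wk) with u ∈? Z | w ∈? Z
  ... | yes u∈Z | _      = inj₂ (u , u∈Z , here , step (R-sym (u≢w , wk)) here)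
  ... | no _   | yes w∈Z = inj₂ (w , w∈Z , step (u≢w , wk) here , here)
  ... | no u∉Z | no w∉Z with avoidOrMeet u∉Z wk
  ...   | inj₁ (i , j , refl , refl , hw) = inj₁ (i , j , refl , refl , (λ i≡j → u≢w (cong f i≡j)) , hw)
  ...   | inj₂ (z , z∈Z , u→z , z→w) =
          inj₂ (z , z∈Z , near u∉Z z∈Z u→z , near w∉Z z∈Z (WalkAlgebra.reverse (Adj G) Adj-sym z→w))

  open Decompose R R-sym c Clean Z N cleanRun classify public using (weakDiameter)

plusNice : ∀ ℓ N n m (F : GraphClass) → Nice (suc m) ℓ N F →
           Nice (suc m) ℓ (diameterBound N n) (PlusN F n)
plusNice ℓ N n m F nice k G (Z , |Z|≤n , k' , H , f , f-inj , f∉Z , f-onto , f-iso , H∈F)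
  with nice k' H H∈F
... | (cH , cH-diam) = E.c , λ u v → E.weakDiameter n |Z|≤n
  where module E = Extension ℓ N G Z H f f-inj f∉Z f-onto f-iso cH cH-diam

lemma4p2 : (ℓ N n : ℕ) → 1 ≤ ℓ → 1 ≤ N →
    ∃[ N* ] ((m : ℕ) → 1 ≤ m → (F : GraphClass) →
    Nice m ℓ N F → Nice m ℓ N* (PlusN F n))
lemma4p2 ℓ N n _ _ = diameterBound N n , niceForAllM
  where
  niceForAllM : (m : ℕ) → 1 ≤ m → (F : GraphClass) →
                Nice m ℓ N F → Nice m ℓ (diameterBound N n) (PlusN F n)
  niceForAllM (suc m) _ = plusNice ℓ N n m
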